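{- Let $\Phi$ be an orientable directed embedding (with a fixed orientation) of an eulerian digraph $D$, and let $f$ be an odd vertex identification from $D$ to $D/f$ with $\ell$ exceptional vertices. Let $\mathcal{A}$ be a set of antifaces of $\Phi$ such that for every $w\in V(D/f)$ with $|f^{ -1}(w)|\ge 2$, every element of $f^{ -1}(w)$ is incident with some element of $\mathcal{A}$. Then $D/f$ has an orientable directed embedding $\Phi'$ whose faces are the faces $B/f$ for all faces $B\notin\mathcal{A}$ of $\Phi$ together with a set $\mathcal{A}'$ of antifaces replacing $\mathcal{A}$, such that $|\mathcal{A}'|\le|\mathcal{A}|+\ell$ and $\mathcal{A}'$ uses the same set of half-arcs as $\mathcal{A}$.
   Context: Digraphs are finite and may have loops and multiple arcs; each arc consists of two half-arcs. A digraph is eulerian if it has a directed circuit using every arc and vertex. Embeddings are cellular in closed surfaces; a directed embedding has every face bounded by a directed closed walk. In an oriented directed embedding, an antiface is a face whose facial directed walk is anticlockwise (a proface: clockwise). A vertex identification $f$ from $D$ is a surjection from $V(D)$ onto a set $V(F)$; $D/f$ is obtained by identifying each preimage $f^{ -1}(w)$ into a single vertex $w$, keeping the same half-arcs and arcs; for a walk $W$, $W/f$ replaces each vertex $u$ by $f(u)$. A vertex identification $f$ is an odd vertex identification with $\ell$ exceptional vertices if there are exactly $\ell$ vertices $w$ of $D/f$ for which $|f^{ -1}(w)|$ is even. -}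

module Defs where

open import Data.Nat using (ℕ; zero; suc; _≤_; _+_)
open import Data.Nat.Divisibility using (_∣_; _∣?_)
open import Data.Fin using (Fin; _≟_)
open import Data.List using (List; []; _∷_; length; filter; allFin)
open import Data.List.Relation.Unary.Any using (Any)
open import Data.List.Relation.Unary.AllPairs using (AllPairs)
open import Data.List.Relation.Binary.Permutation.Propositional using (_↭_)
open import Data.List.Membership.Propositional using (_∈_)
open import Data.Product using (Σ; ∃; ∃-syntax; _×_; _,_; proj₂)
open import Data.Sum using (_⊎_)
open import Relation.Nullary using (¬_)
open import Relation.Binary.PropositionalEquality using (_≡_)

record Digraph : Set where
  field
    nV   : ℕ
    nA   : ℕ
    tail : Fin nA → Fin nV
    head : Fin nA → Fin nV
open Digraph public

data End : Set where
  tl hd : End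

flipEnd : End → End
flipEnd tl = hd
flipEnd hd = tl

HalfArc : Digraph → Set
HalfArc D = Fin (nA D) × End

vtx : (D : Digraph) → HalfArc D → Fin (nV D)
vtx D (a , tl) = tail D a
vtx D (a , hd) = head D a

other : (D : Digraph) → HalfArc D → HalfArc D
other D (a , e) = (a , flipEnd e)

iter : {A : Set} → (A → A) → ℕ → A → A
iter g zero x = x
iter g (suc k) x = g (iter g k x)

data Walk (D : Digraph) : Fin (nV D) → List (Fin (nA D)) → Fin (nV D) → Set where
  stop : ∀ {v} → Walk D v [] v
  step : ∀ {a as w} → Walk D (head D a) as w → Walk D (tail D a) (a ∷ as) w

Eulerian : Digraph → Set
Eulerian D =
  Σ (Fin (nV D)) λ s → Σ (List (Fin (nA D))) λ as →
    Walk D s as s × (as ↭ allFin (nA D)) ×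
    (∀ v → v ≡ s ⊎ Any (λ a → tail D a ≡ v) as)

-- Oriented embeddings as rotation systems (Heffter–Edmonds).
-- rot h is the successor of h in the (clockwise) cyclic order of the
-- half-arcs at the vertex vtx h.  Faces are the orbits of
-- faceStep h = rot (other h); the face walk through h leaves vtx h along
-- the arc of h.

record OrientedEmbedding (D : Digraph) : Set where
  field
    rot     : HalfArc D → HalfArc D
    rotInv  : HalfArc D → HalfArc D
    rot-inv₁ : ∀ h → rot (rotInv h) ≡ h
    rot-inv₂ : ∀ h → rotInv (rot h) ≡ h
    rot-vtx  : ∀ h → vtx D (rot h) ≡ vtx D h
    rot-cyc  : ∀ h h' → vtx D h ≡ vtx D h' → ∃[ k ] iter rot k h ≡ h'
open OrientedEmbedding public

faceStep : {D : Digraph} → OrientedEmbedding D → HalfArc D → HalfArc D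
faceStep {D} Φ h = rot Φ (other D h)

SameFace : {D : Digraph} → OrientedEmbedding D → HalfArc D → HalfArc D → Set
SameFace Φ h h' = ∃[ k ] iter (faceStep Φ) k h ≡ h'

-- face walk through h traverses arc of the half-arc iter faceStep k h
-- forwards iff that half-arc is a tail half-arc.
-- Directed embedding: every face is a directed closed walk, i.e. all arcs of
-- the face are traversed in the same direction.
IsDirected : {D : Digraph} → OrientedEmbedding D → Set
IsDirected Φ = ∀ h k → proj₂ (iter (faceStep Φ) k h) ≡ proj₂ h

-- the face through h is an antiface: its facial directed walk runs against
-- the (clockwise) face-tracing direction, i.e. it is anticlockwise.
IsAntiface : {D : Digraph} → OrientedEmbedding D → HalfArc D → Set
IsAntiface Φ h = ∀ k → proj₂ (iter (faceStep Φ) k h) ≡ hd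

record OrientedDirectedEmbedding (D : Digraph) : Set where
  field
    emb      : OrientedEmbedding D
    directed : IsDirected emb
open OrientedDirectedEmbedding public

-- A set of antifaces, given by a list of representative half-arcs, one per
-- face, all antifaces, pairwise on distinct faces.  Its size is the length.
IsAntifaceSet : {D : Digraph} → OrientedEmbedding D → List (HalfArc D) → Set
IsAntifaceSet Φ 𝒜 =
  (∀ r → r ∈ 𝒜 → IsAntiface Φ r) × AllPairs (λ r s → ¬ SameFace Φ r s) 𝒜

InFaces : {D : Digraph} → OrientedEmbedding D → List (HalfArc D) → HalfArc D → Set
InFaces Φ 𝒜 h = Any (λ r → SameFace Φ r h) 𝒜

IncidentWith : {D : Digraph} → OrientedEmbedding D → List (HalfArc D) → Fin (nV D) → Set
IncidentWith {D} Φ 𝒜 v = ∃[ h ] InFaces Φ 𝒜 h × vtx D h ≡ v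

Surjective : {n n' : ℕ} → (Fin n → Fin n') → Set
Surjective {n} {n'} f = ∀ w → ∃[ v ] f v ≡ w

_/_ : (D : Digraph) → {n' : ℕ} → (Fin (nV D) → Fin n') → Digraph
_/_ D {n'} f = record { nV = n' ; nA = nA D
                      ; tail = λ a → f (tail D a) ; head = λ a → f (head D a) }

preimageSize : {n n' : ℕ} → (Fin n → Fin n') → Fin n' → ℕ
preimageSize {n} f w = length (filter (λ v → f v ≟ w) (allFin n))

numExceptional : {n n' : ℕ} → (Fin n → Fin n') → ℕ
numExceptional {n' = n'} f = length (filter (λ w → 2 ∣? preimageSize f w) (allFin n'))

OddVertexIdentification : {n n' : ℕ} → (Fin n → Fin n') → ℕ → Set
OddVertexIdentification f ℓ = Surjective f × numExceptional f ≡ ℓ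

module Submission where

-- Identify the vertices of each fibre f⁻¹(w) one at a time into the first vertex v of the fibre.
-- Identifying u with v is the rotation surgery ρ' = ρ ∘ (p q), where p is a half-arc at u and q one at v
-- whose opposite half-arcs p̄, q̄ lie on faces of 𝒜.  It merges the rotations at u and v, and since
-- ρ' ∘ other = (ρ ∘ other) ∘ (p̄ q̄) it either splits one face of 𝒜 into two or joins two of them,
-- leaving every other face alone; p̄ and q̄ are head half-arcs, so all faces stay directed and the new
-- ones are antifaces.  After a split we keep two half-arcs at v whose opposites lie on different
-- faces, so the next surgery can be chosen to be a join.  Thus splits and joins alternate, and a fibre
-- of size k adds at most one antiface, none when k is odd.

open import Defs
open import Data.Nat using (ℕ; zero; suc; _+_; _*_; _∸_; _≤_; _<_; _≥_; z≤n; s≤s; _<?_; _≤?_; _≟_)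
open import Data.Nat.Properties
open import Data.Nat.DivMod using (_%_; m≡m%n+[m/n]*n; m%n<n) renaming (_/_ to _div_)
open import Data.Nat.Divisibility using (_∣_; _∣?_; divides)
open import Data.Fin using (Fin; toℕ; fromℕ<; combine) renaming (_≟_ to _≟ᶠ_)
open import Data.Fin.Properties using (pigeonhole; any?; toℕ-fromℕ<; combine-injective)
open import Data.Product using (Σ; Σ-syntax; ∃-syntax; _×_; _,_; proj₁; proj₂)
open import Data.Product.Properties using (≡-dec)
open import Data.Sum using (_⊎_; inj₁; inj₂; [_,_]′)
import Data.Sum
open import Data.Empty using (⊥-elim)
open import Data.List using (List; []; _∷_; length; filter; allFin)
open import Data.List.Properties using (filter-notAll; filter-accept; filter-reject)
open import Data.List.Relation.Unary.Any as Any using (Any; here; there)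
open import Data.List.Relation.Unary.All as All using (All; []; _∷_)
open import Data.List.Relation.Unary.All.Properties using (all-filter)
open import Data.List.Relation.Unary.AllPairs as AllPairs using (AllPairs; []; _∷_)
import Data.List.Relation.Unary.AllPairs.Properties as AllPairs
open import Data.List.Relation.Unary.Unique.Propositional using (Unique)
open import Data.List.Relation.Unary.Unique.Propositional.Properties using (allFin⁺)
import Data.List.Relation.Unary.Unique.Propositional.Properties as Unique
open import Data.List.Membership.Propositional using (_∈_; find; lose)
open import Data.List.Membership.Propositional.Properties using (∈-filter⁺; ∈-filter⁻; ∈-allFin)
open import Function.Base using (case_of_)
open import Function.Bundles using (_⇔_; mk⇔; Equivalence)
open import Function.Definitions using (Injective)
open import Relation.Nullary using (¬_; Dec; yes; no; ¬?)
open import Relation.Binary.Definitions using (DecidableEquality)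
open import Relation.Binary.PropositionalEquality

module _ {A : Set} (g : A → A) where

  iter-+ : ∀ m n x → iter g (m + n) x ≡ iter g m (iter g n x)
  iter-+ zero    n x = refl
  iter-+ (suc m) n x = cong g (iter-+ m n x)

  iter-suc : ∀ n x → iter g (suc n) x ≡ iter g n (g x)
  iter-suc zero    x = refl
  iter-suc (suc n) x = cong g (iter-suc n x)

  iter-comm : ∀ m n x → iter g m (iter g n x) ≡ iter g n (iter g m x)
  iter-comm m n x = begin
    iter g m (iter g n x) ≡⟨ iter-+ m n x ⟨
    iter g (m + n) x      ≡⟨ cong (λ k → iter g k x) (+-comm m n) ⟩
    iter g (n + m) x      ≡⟨ iter-+ n m x ⟩
    iter g n (iter g m x) ∎
    where open ≡-Reasoning

  iter-injective : Injective _≡_ _≡_ g → ∀ k → Injective _≡_ _≡_ (iter g k)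
  iter-injective g-inj zero    eq = eq
  iter-injective g-inj (suc k) eq = iter-injective g-inj k (g-inj eq)

  iter-*-fixed : ∀ {p x} → iter g p x ≡ x → ∀ q → iter g (q * p) x ≡ x
  iter-*-fixed         fixed zero    = refl
  iter-*-fixed {p} {x} fixed (suc q) =
    trans (iter-+ p (q * p) x) (trans (cong (iter g p) (iter-*-fixed fixed q)) fixed)

  iter-% : ∀ {p x} → iter g (suc p) x ≡ x → ∀ k → iter g k x ≡ iter g (k % suc p) x
  iter-% {p} {x} fixed k = begin
    iter g k x                                            ≡⟨ cong (λ n → iter g n x) (m≡m%n+[m/n]*n k (suc p)) ⟩
    iter g (k % suc p + (k div suc p) * suc p) x          ≡⟨ iter-+ (k % suc p) _ x ⟩
    iter g (k % suc p) (iter g ((k div suc p) * suc p) x) ≡⟨ cong (iter g (k % suc p)) (iter-*-fixed fixed (k div suc p)) ⟩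
    iter g (k % suc p) x                                  ∎
    where open ≡-Reasoning

  iter-periodic-all : ∀ {p x} (P : A → Set) → iter g (suc p) x ≡ x →
                      (∀ i → i < suc p → P (iter g i x)) → ∀ k → P (iter g k x)
  iter-periodic-all {p} {x} P fixed first k =
    subst P (sym (iter-% fixed k)) (first (k % suc p) (m%n<n k (suc p)))

Orbit : {A : Set} → (A → A) → A → A → Set
Orbit g x y = ∃[ k ] iter g k x ≡ y

Orbit-refl : ∀ {A : Set} {g : A → A} {x} → Orbit g x x
Orbit-refl = 0 , refl

Orbit-trans : ∀ {A : Set} {g : A → A} {x y z} → Orbit g x y → Orbit g y z → Orbit g x z
Orbit-trans {g = g} {x} (k , refl) (j , refl) = j + k , iter-+ g j k x

Orbit-step : ∀ {A : Set} {g : A → A} {x y} → Orbit g x y → Orbit g x (g y)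
Orbit-step (k , refl) = suc k , refl

Representatives : {A : Set} → (A → A) → (A → Set) → List A → Set
Representatives g P rs = AllPairs (λ r s → ¬ Orbit g r s) rs × (∀ x → P x ⇔ Any (λ r → Orbit g r x) rs)

module _ {A : Set} {g : A → A} {P : A → Set} {rs : List A} (reps : Representatives g P rs) where

  Representatives-member : ∀ {r} → r ∈ rs → P r
  Representatives-member r∈ = Equivalence.from (proj₂ reps _) (lose r∈ Orbit-refl)

  Representatives-closed : ∀ {x} → P x → P (g x)
  Representatives-closed px with find (Equivalence.to (proj₂ reps _) px)
  ... | r , r∈ , r→x = Equivalence.from (proj₂ reps _) (lose r∈ (Orbit-step r→x))

AllPairs-mapWithAll : ∀ {A : Set} {P : A → Set} {R S : A → A → Set} →
  (∀ {x y} → P x → P y → R x y → S x y) → ∀ {xs} → All P xs → AllPairs R xs → AllPairs S xs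
AllPairs-mapWithAll f []         []         = []
AllPairs-mapWithAll f (px ∷ pxs) (rx ∷ rxs) = All.zipWith (λ (py , r) → f px py r) (pxs , rx)
                                            ∷ AllPairs-mapWithAll f pxs rxs

inverse⇒injective : ∀ {A : Set} {g g⁻¹ : A → A} → (∀ x → g⁻¹ (g x) ≡ x) → Injective _≡_ _≡_ g
inverse⇒injective {g⁻¹ = g⁻¹} inverse {x} {y} eq = trans (sym (inverse x)) (trans (cong g⁻¹ eq) (inverse y))

module _ {P : ℕ → Set} (P? : ∀ n → Dec (P n)) where

  private
    leastBelow : ∀ n → (∃[ m ] m < n × P m × (∀ i → i < m → ¬ P i)) ⊎ (∀ i → i < n → ¬ P i)
    leastBelow zero = inj₂ (λ _ ())
    leastBelow (suc n) with leastBelow n | P? n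
    ... | inj₁ (m , m<n , pm , below) | _      = inj₁ (m , m<n⇒m<1+n m<n , pm , below)
    ... | inj₂ none                   | yes pn = inj₁ (n , n<1+n n , pn , none)
    ... | inj₂ none                   | no ¬pn = inj₂ λ i i<1+n → [ none i , (λ { refl → ¬pn }) ]′ (m<1+n⇒m<n∨m≡n i<1+n)

  least : ∀ {n} → P n → ∃[ m ] P m × (∀ i → i < m → ¬ P i)
  least {n} pn with leastBelow (suc n)
  ... | inj₁ (m , _ , pm , below) = m , pm , below
  ... | inj₂ none                 = ⊥-elim (none n (n<1+n n) pn)

module Swap {X : Set} (_≟_ : DecidableEquality X) where

  swap : X → X → X → X
  swap a b y with y ≟ a | y ≟ b
  ... | yes _ | _     = b
  ... | no _  | yes _ = a
  ... | no _  | no _  = y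

  swap-left : ∀ a b → swap a b a ≡ b
  swap-left a b with a ≟ a
  ... | yes _  = refl
  ... | no a≢a = ⊥-elim (a≢a refl)

  swap-right : ∀ a b → swap a b b ≡ a
  swap-right a b with b ≟ a | b ≟ b
  ... | yes b≡a | _      = b≡a
  ... | no _    | yes _  = refl
  ... | no _    | no b≢b = ⊥-elim (b≢b refl)

  swap-other : ∀ {a b y} → y ≢ a → y ≢ b → swap a b y ≡ y
  swap-other {a} {b} {y} y≢a y≢b with y ≟ a | y ≟ b
  ... | yes y≡a | _       = ⊥-elim (y≢a y≡a)
  ... | no _    | yes y≡b = ⊥-elim (y≢b y≡b)
  ... | no _    | no _    = refl

  swap-involutive : ∀ a b y → swap a b (swap a b y) ≡ y
  swap-involutive a b y with y ≟ a | y ≟ b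
  ... | yes refl | _        = swap-right y b
  ... | no _     | yes refl = swap-left a y
  ... | no y≢a   | no y≢b   = swap-other y≢a y≢b

  swap-injective : ∀ a b → Injective _≡_ _≡_ (swap a b)
  swap-injective a b {x} {y} eq =
    trans (sym (swap-involutive a b x)) (trans (cong (swap a b) eq) (swap-involutive a b y))

  swap-invariant : ∀ {B : Set} (g : X → B) {a b} → g a ≡ g b → ∀ y → g (swap a b y) ≡ g y
  swap-invariant g {a} {b} ga≡gb y with y ≟ a | y ≟ b
  ... | yes refl | _        = sym ga≡gb
  ... | no _     | yes refl = ga≡gb
  ... | no _     | no _     = refl

  swap-preserves : ∀ (P : X → Set) {a b} → P a → P b → ∀ {y} → P y → P (swap a b y)
  swap-preserves P {a} {b} pa pb {y} py with y ≟ a | y ≟ b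
  ... | yes _ | _     = pb
  ... | no _  | yes _ = pa
  ... | no _  | no _  = py

  swap-conjugate : ∀ (g : X → X) → (∀ x → g (g x) ≡ x) →
                   ∀ p q y → g (swap (g p) (g q) y) ≡ swap p q (g y)
  swap-conjugate g involutive p q y with y ≟ g p | y ≟ g q
  ... | yes refl | _        = trans (involutive q) (sym (trans (cong (swap p q) (involutive p)) (swap-left p q)))
  ... | no _     | yes refl = trans (involutive p) (sym (trans (cong (swap p q) (involutive q)) (swap-right p q)))
  ... | no y≢gp  | no y≢gq  = sym (swap-other (λ gy≡p → y≢gp (trans (sym (involutive y)) (cong g gy≡p)))
                                              (λ gy≡q → y≢gq (trans (sym (involutive y)) (cong g gy≡q))))

module FiniteOrbits {X : Set} (_≟_ : DecidableEquality X) {N : ℕ} (encode : X → Fin N)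
                    (encode-injective : Injective _≡_ _≡_ encode) where

  open Swap _≟_

  private
    Permutation : (X → X) → Set
    Permutation σ = Injective _≡_ _≡_ σ

  MinimalPeriod : (X → X) → X → ℕ → Set
  MinimalPeriod σ x p = iter σ (suc p) x ≡ x × (∀ i → i < p → iter σ (suc i) x ≢ x)

  -- Abstract, so that the searches behind these witnesses are never unfolded during type checking.
  abstract
    period : ∀ {σ} → Permutation σ → ∀ x → ∃[ p ] iter σ (suc p) x ≡ x
    period {σ} σ-inj x with pigeonhole (n<1+n N) (λ i → encode (iter σ (toℕ i) x))
    ... | i , j , i<j , same = returns (toℕ j ∸ toℕ i) (m<n⇒0<n∸m i<j) (sym (iter-injective σ σ-inj (toℕ i) shifted))
      where
      shifted : iter σ (toℕ i) x ≡ iter σ (toℕ i) (iter σ (toℕ j ∸ toℕ i) x)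
      shifted = trans (encode-injective same)
        (trans (cong (λ n → iter σ n x) (sym (m+[n∸m]≡n (<⇒≤ i<j)))) (iter-+ σ (toℕ i) _ x))
      returns : ∀ d → 0 < d → iter σ d x ≡ x → ∃[ p ] iter σ (suc p) x ≡ x
      returns (suc d) _ back = d , back

    minimalPeriod : ∀ {σ} → Permutation σ → ∀ x → ∃[ p ] MinimalPeriod σ x p
    minimalPeriod {σ} σ-inj x with period σ-inj x
    ... | p₀ , back₀ = least {P = λ n → iter σ (suc n) x ≡ x} (λ n → iter σ (suc n) x ≟ x) {p₀} back₀

    Orbit-sym : ∀ {σ} → Permutation σ → ∀ {x y} → Orbit σ x y → Orbit σ y x
    Orbit-sym {σ} σ-inj {x} (k , refl) with period σ-inj x
    ... | p , back = k * p , (begin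
      iter σ (k * p) (iter σ k x) ≡⟨ iter-+ σ (k * p) k x ⟨
      iter σ (k * p + k) x        ≡⟨ cong (λ n → iter σ n x) (trans (+-comm (k * p) k) (sym (*-suc k p))) ⟩
      iter σ (k * suc p) x        ≡⟨ iter-*-fixed σ back k ⟩
      x                           ∎)
      where open ≡-Reasoning

    Orbit? : ∀ {σ} → Permutation σ → ∀ x y → Dec (Orbit σ x y)
    Orbit? {σ} σ-inj x y with period σ-inj x
    ... | p , back with any? {n = suc p} (λ i → iter σ (toℕ i) x ≟ y)
    ... | yes (i , hit) = yes (toℕ i , hit)
    ... | no none       = no λ (k , hit) → none (fromℕ< (m%n<n k (suc p)) ,
            trans (cong (λ n → iter σ n x) (toℕ-fromℕ< (m%n<n k (suc p)))) (trans (sym (iter-% σ back k)) hit))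

  module Transposition {σ τ : X → X} (σ-inj : Permutation σ) (a b : X)
                       (τ-def : ∀ y → τ y ≡ σ (swap a b y)) where

    τ-injective : Permutation τ
    τ-injective {x} {y} eq = swap-injective a b (σ-inj (trans (sym (τ-def x)) (trans eq (τ-def y))))

    Avoids : X → ℕ → Set
    Avoids y n = ∀ i → i < n → iter σ i y ≢ a × iter σ i y ≢ b

    Avoids-≤ : ∀ {y m n} → Avoids y n → m ≤ n → Avoids y m
    Avoids-≤ avoids m≤n i i<m = avoids i (<-≤-trans i<m m≤n)

    iter-τ-avoiding : ∀ {y} n → Avoids y n → iter τ n y ≡ iter σ n y
    iter-τ-avoiding         zero    _      = refl
    iter-τ-avoiding {y} (suc n) avoids = begin
      τ (iter τ n y)            ≡⟨ cong τ (iter-τ-avoiding n (Avoids-≤ avoids (n≤1+n n))) ⟩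
      τ (iter σ n y)            ≡⟨ τ-def _ ⟩
      σ (swap a b (iter σ n y)) ≡⟨ cong σ (swap-other (proj₁ (avoids n (n<1+n n))) (proj₂ (avoids n (n<1+n n)))) ⟩
      σ (iter σ n y)            ∎
      where open ≡-Reasoning

    iter-τ-from-a : ∀ n → Avoids (σ b) n → iter τ (suc n) a ≡ iter σ n (σ b)
    iter-τ-from-a n avoids = begin
      iter τ (suc n) a ≡⟨ iter-suc τ n a ⟩
      iter τ n (τ a)   ≡⟨ cong (iter τ n) (trans (τ-def a) (cong σ (swap-left a b))) ⟩
      iter τ n (σ b)   ≡⟨ iter-τ-avoiding n avoids ⟩
      iter σ n (σ b)   ∎
      where open ≡-Reasoning

    iter-τ-from-b : ∀ n → Avoids (σ a) n → iter τ (suc n) b ≡ iter σ n (σ a)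
    iter-τ-from-b n avoids = begin
      iter τ (suc n) b ≡⟨ iter-suc τ n b ⟩
      iter τ n (τ b)   ≡⟨ cong (iter τ n) (trans (τ-def b) (cong σ (swap-right a b))) ⟩
      iter τ n (σ a)   ≡⟨ iter-τ-avoiding n avoids ⟩
      iter σ n (σ a)   ∎
      where open ≡-Reasoning

    module _ {x : X} (x↛a : ¬ Orbit σ x a) (x↛b : ¬ Orbit σ x b) where

      iter-τ-outside : ∀ k → iter τ k x ≡ iter σ k x
      iter-τ-outside k = iter-τ-avoiding k λ i _ → (λ hit → x↛a (i , hit)) , (λ hit → x↛b (i , hit))

      Orbit-τ⇒σ : ∀ {y} → Orbit τ x y → Orbit σ x y
      Orbit-τ⇒σ (k , hit) = k , trans (sym (iter-τ-outside k)) hit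

      Orbit-σ⇒τ : ∀ {y} → Orbit σ x y → Orbit τ x y
      Orbit-σ⇒τ (k , hit) = k , trans (iter-τ-outside k) hit

    module Split (a≢b : a ≢ b) {m p : ℕ} (hit : iter σ (suc m) a ≡ b)
                 (firstHit : ∀ i → i < suc m → iter σ i a ≢ b) (minimal : MinimalPeriod σ a p) where

      returns : iter σ (suc p) a ≡ a
      returns = proj₁ minimal

      noEarlyReturn : ∀ i → i < p → iter σ (suc i) a ≢ a
      noEarlyReturn = proj₂ minimal

      m<p : m < p
      m<p with m <? p
      ... | yes m<p = m<p
      ... | no m≮p  = ⊥-elim (firstHit (m ∸ p) (s≤s (m∸n≤m m p)) hitEarlier)
        where
        hitEarlier : iter σ (m ∸ p) a ≡ b
        hitEarlier = begin
          iter σ (m ∸ p) a                    ≡⟨ cong (iter σ (m ∸ p)) returns ⟨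
          iter σ (m ∸ p) (iter σ (suc p) a)   ≡⟨ iter-+ σ (m ∸ p) (suc p) a ⟨
          iter σ (suc m ∸ suc p + suc p) a    ≡⟨ cong (λ n → iter σ n a) (m∸n+n≡m (s≤s (≮⇒≥ m≮p))) ⟩
          iter σ (suc m) a                    ≡⟨ hit ⟩
          b                                   ∎
          where open ≡-Reasoning

      d : ℕ
      d = p ∸ suc m

      d+1+m≡p : d + suc m ≡ p
      d+1+m≡p = trans (+-comm d (suc m)) (m+[n∸m]≡n m<p)

      iter-past-b : ∀ e → iter σ (suc e + suc m) a ≡ iter σ e (σ b)
      iter-past-b e = begin
        iter σ (suc e + suc m) a          ≡⟨ iter-+ σ (suc e) (suc m) a ⟩
        iter σ (suc e) (iter σ (suc m) a) ≡⟨ cong (iter σ (suc e)) hit ⟩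
        iter σ (suc e) b                  ≡⟨ iter-suc σ e b ⟩
        iter σ e (σ b)                    ∎
        where open ≡-Reasoning

      b-returns⇒a-returns : ∀ i → iter σ i b ≡ b → iter σ i a ≡ a
      b-returns⇒a-returns i b-back = iter-injective σ σ-inj (suc m)
        (trans (iter-comm σ (suc m) i a) (trans (cong (iter σ i) hit) (trans b-back (sym hit))))

      avoids-after-a : Avoids (σ a) m
      avoids-after-a i i<m = (λ back → noEarlyReturn i (<-trans i<m m<p) (trans (iter-suc σ i a) back))
                           , (λ hitB → firstHit (suc i) (s≤s i<m) (trans (iter-suc σ i a) hitB))

      avoids-after-b : Avoids (σ b) d
      avoids-after-b i i<d =
          (λ back → noEarlyReturn (i + suc m) i+1+m<p (trans (iter-past-b i) back))
        , (λ back → noEarlyReturn i (<-≤-trans i<d (m∸n≤m p (suc m)))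
                      (b-returns⇒a-returns (suc i) (trans (iter-suc σ i b) back)))
        where
        i+1+m<p : i + suc m < p
        i+1+m<p = subst (i + suc m <_) d+1+m≡p (+-monoˡ-< (suc m) i<d)

      τ-returns : iter τ (suc d) a ≡ a
      τ-returns = begin
        iter τ (suc d) a         ≡⟨ iter-τ-from-a d avoids-after-b ⟩
        iter σ d (σ b)           ≡⟨ iter-past-b d ⟨
        iter σ (suc d + suc m) a ≡⟨ cong (λ n → iter σ (suc n) a) d+1+m≡p ⟩
        iter σ (suc p) a         ≡⟨ returns ⟩
        a                        ∎
        where open ≡-Reasoning

      separated : ¬ Orbit τ a b
      separated (k , hitB) = iter-periodic-all τ (_≢ b) τ-returns firstCycle k hitB
        where
        firstCycle : ∀ i → i < suc d → iter τ i a ≢ b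
        firstCycle zero    _         = a≢b
        firstCycle (suc j) (s≤s j<d) = subst (_≢ b)
          (sym (iter-τ-from-a j (Avoids-≤ avoids-after-b (<⇒≤ j<d)))) (proj₂ (avoids-after-b j j<d))

      covered : ∀ x → Orbit σ a x → Orbit τ a x ⊎ Orbit τ b x
      covered x (k , refl) = iter-periodic-all σ (λ y → Orbit τ a y ⊎ Orbit τ b y) returns firstCycle k
        where
        firstCycle : ∀ i → i < suc p → Orbit τ a (iter σ i a) ⊎ Orbit τ b (iter σ i a)
        firstCycle zero    _ = inj₁ Orbit-refl
        firstCycle (suc j) (s≤s j<p) with j ≤? m
        ... | yes j≤m = inj₂ (suc j , trans (iter-τ-from-b j (Avoids-≤ avoids-after-a j≤m)) (sym (iter-suc σ j a)))
        ... | no j≰m  = inj₁ (suc e , (begin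
          iter τ (suc e) a         ≡⟨ iter-τ-from-a e (Avoids-≤ avoids-after-b (<⇒≤ e<d)) ⟩
          iter σ e (σ b)           ≡⟨ iter-past-b e ⟨
          iter σ (suc e + suc m) a ≡⟨ cong (λ n → iter σ (suc n) a) (trans (+-comm e (suc m)) 1+m+e≡j) ⟩
          iter σ (suc j) a         ∎))
          where
          open ≡-Reasoning
          e : ℕ
          e = j ∸ suc m
          1+m+e≡j : suc m + e ≡ j
          1+m+e≡j = m+[n∸m]≡n (≰⇒> j≰m)
          e<d : e < d
          e<d = +-cancelˡ-< (suc m) e d (subst₂ _<_ (sym 1+m+e≡j) (sym (m+[n∸m]≡n m<p)) j<p)

    module Join (apart : ¬ Orbit σ a b) {p q : ℕ}
                (minimal-a : MinimalPeriod σ a p) (minimal-b : MinimalPeriod σ b q) where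

      avoids-after-a : Avoids (σ a) p
      avoids-after-a i i<p = (λ back → proj₂ minimal-a i i<p (trans (iter-suc σ i a) back))
                           , (λ hitB → apart (suc i , trans (iter-suc σ i a) hitB))

      avoids-after-b : Avoids (σ b) q
      avoids-after-b i i<q = (λ hitA → apart (Orbit-sym σ-inj (suc i , trans (iter-suc σ i b) hitA)))
                           , (λ back → proj₂ minimal-b i i<q (trans (iter-suc σ i b) back))

      reaches-b : Orbit τ a b
      reaches-b = suc q , trans (iter-τ-from-a q avoids-after-b) (trans (sym (iter-suc σ q b)) (proj₁ minimal-b))

      joined : ∀ x → Orbit σ a x ⊎ Orbit σ b x → Orbit τ a x
      joined x (inj₁ (k , refl)) = iter-periodic-all σ (Orbit τ a) (proj₁ minimal-a) firstCycle k
        where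
        firstCycle : ∀ i → i < suc p → Orbit τ a (iter σ i a)
        firstCycle zero    _         = Orbit-refl
        firstCycle (suc j) (s≤s j<p) = Orbit-trans reaches-b
          (suc j , trans (iter-τ-from-b j (Avoids-≤ avoids-after-a (<⇒≤ j<p))) (sym (iter-suc σ j a)))
      joined x (inj₂ (k , refl)) = iter-periodic-all σ (Orbit τ a) (proj₁ minimal-b) firstCycle k
        where
        firstCycle : ∀ i → i < suc q → Orbit τ a (iter σ i b)
        firstCycle zero    _         = reaches-b
        firstCycle (suc j) (s≤s j<q) =
          suc j , trans (iter-τ-from-a j (Avoids-≤ avoids-after-b (<⇒≤ j<q))) (sym (iter-suc σ j b))

    split : a ≢ b → Orbit σ a b → ¬ Orbit τ a b × (∀ x → Orbit σ a x → Orbit τ a x ⊎ Orbit τ b x)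
    split a≢b (k , hit) with least {P = λ n → iter σ n a ≡ b} (λ n → iter σ n a ≟ b) {k} hit
    ... | zero  , hit₀ , _        = ⊥-elim (a≢b hit₀)
    ... | suc m , hit , firstHit  = Split.separated a≢b hit firstHit minimal , Split.covered a≢b hit firstHit minimal
      where
      minimal : MinimalPeriod σ a (proj₁ (minimalPeriod σ-inj a))
      minimal = proj₂ (minimalPeriod σ-inj a)

    join : ¬ Orbit σ a b → ∀ x → Orbit σ a x ⊎ Orbit σ b x → Orbit τ a x
    join apart = Join.joined apart (proj₂ (minimalPeriod σ-inj a)) (proj₂ (minimalPeriod σ-inj b))

    module _ {P : X → Set} (Pa : P a) (Pb : P b) {rs : List X} (reps : Representatives σ P rs) where

      τ-closed : ∀ {x y} → Orbit τ x y → P x → P y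
      τ-closed (zero  , refl) px = px
      τ-closed (suc k , refl) px = subst P (sym (τ-def _))
        (Representatives-closed reps (swap-preserves P Pa Pb (τ-closed (k , refl) px)))

      τ-covered⇒P : ∀ {rs'} → (∀ {r} → r ∈ rs' → P r) → ∀ x → Any (λ r → Orbit τ r x) rs' → P x
      τ-covered⇒P members x covered with find covered
      ... | r , r∈ , r→x = τ-closed r→x (members r∈)

      P⇒σ-covered : ∀ {x} → P x → Any (λ r → Orbit σ r x) rs
      P⇒σ-covered {x} = Equivalence.to (proj₂ reps x)

      representatives-split : a ≢ b → Orbit σ a b →
        Σ[ rs' ∈ List X ] Representatives τ P rs' × length rs' ≤ suc (length rs)
      representatives-split a≢b a→b = a ∷ b ∷ kept , (distinct , λ x → mk⇔ (covers x) (τ-covered⇒P members x))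
                                    , s≤s (filter-notAll keep? rs (Any.map (λ r→a r↛a → r↛a r→a) (P⇒σ-covered Pa)))
        where
        keep? : ∀ r → Dec (¬ Orbit σ r a)
        keep? r = ¬? (Orbit? σ-inj r a)
        kept : List X
        kept = filter keep? rs
        ↛b : ∀ {r} → ¬ Orbit σ r a → ¬ Orbit σ r b
        ↛b r↛a r→b = r↛a (Orbit-trans r→b (Orbit-sym σ-inj a→b))
        kept-outside : All (λ r → ¬ Orbit σ r a) kept
        kept-outside = all-filter keep? rs
        apart-from : ∀ {c r} → Orbit σ c a → ¬ Orbit σ r a → ¬ Orbit τ c r
        apart-from c→a r↛a c→r =
          r↛a (Orbit-trans (Orbit-τ⇒σ r↛a (↛b r↛a) (Orbit-sym τ-injective c→r)) c→a)
        distinct : AllPairs (λ r s → ¬ Orbit τ r s) (a ∷ b ∷ kept)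
        distinct = (proj₁ (split a≢b a→b) ∷ All.map (apart-from Orbit-refl) kept-outside)
                 ∷ All.map (apart-from (Orbit-sym σ-inj a→b)) kept-outside
                 ∷ AllPairs-mapWithAll (λ r↛a _ r↛s r→s → r↛s (Orbit-τ⇒σ r↛a (↛b r↛a) r→s)) kept-outside
                     (AllPairs.filter⁺ keep? (proj₁ reps))
        members : ∀ {r} → r ∈ a ∷ b ∷ kept → P r
        members (here refl)         = Pa
        members (there (here refl)) = Pb
        members (there (there r∈))  = Representatives-member reps (proj₁ (∈-filter⁻ keep? {xs = rs} r∈))
        covers : ∀ x → P x → Any (λ r → Orbit τ r x) (a ∷ b ∷ kept)
        covers x px with find (P⇒σ-covered px)
        ... | r , r∈ , r→x with Orbit? σ-inj r a
        ...   | no r↛a = there (there (lose (∈-filter⁺ keep? r∈ r↛a) (Orbit-σ⇒τ r↛a (↛b r↛a) r→x)))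
        ...   | yes r→a with proj₂ (split a≢b a→b) x (Orbit-trans (Orbit-sym σ-inj r→a) r→x)
        ...     | inj₁ a→x = here a→x
        ...     | inj₂ b→x = there (here b→x)

      representatives-join : ¬ Orbit σ a b →
        Σ[ rs' ∈ List X ] Representatives τ P rs' × suc (length rs') ≤ length rs
      representatives-join a↛b = kept , (distinct , λ x → mk⇔ (covers x) (τ-covered⇒P members x))
                               , filter-notAll keep? rs (Any.map (λ r→b r↛b → r↛b r→b) (P⇒σ-covered Pb))
        where
        keep? : ∀ r → Dec (¬ Orbit σ r b)
        keep? r = ¬? (Orbit? σ-inj r b)
        kept : List X
        kept = filter keep? rs
        separate : ∀ {r s} → ¬ Orbit σ r b → ¬ Orbit σ s b → ¬ Orbit σ r s → ¬ Orbit τ r s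
        separate {r} {s} r↛b s↛b r↛s r→s with Orbit? σ-inj r a
        ... | no r↛a  = r↛s (Orbit-τ⇒σ r↛a r↛b r→s)
        ... | yes r→a = r↛s (Orbit-sym σ-inj (Orbit-τ⇒σ s↛a s↛b (Orbit-sym τ-injective r→s)))
          where
          s↛a : ¬ Orbit σ s a
          s↛a s→a = r↛s (Orbit-trans r→a (Orbit-sym σ-inj s→a))
        distinct : AllPairs (λ r s → ¬ Orbit τ r s) kept
        distinct = AllPairs-mapWithAll separate (all-filter keep? rs) (AllPairs.filter⁺ keep? (proj₁ reps))
        members : ∀ {r} → r ∈ kept → P r
        members r∈ = Representatives-member reps (proj₁ (∈-filter⁻ keep? {xs = rs} r∈))
        via-a : ∀ {x} → Orbit σ a x ⊎ Orbit σ b x → Any (λ r → Orbit τ r x) kept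
        via-a a∨b→x with find (P⇒σ-covered Pa)
        ... | r , r∈ , r→a = lose (∈-filter⁺ keep? r∈ (λ r→b → a↛b (Orbit-trans (Orbit-sym σ-inj r→a) r→b)))
                                   (Orbit-trans (Orbit-sym τ-injective (join a↛b r (inj₁ (Orbit-sym σ-inj r→a))))
                                                (join a↛b _ a∨b→x))
        covers : ∀ x → P x → Any (λ r → Orbit τ r x) kept
        covers x px with find (P⇒σ-covered px)
        ... | r , r∈ , r→x with Orbit? σ-inj r a | Orbit? σ-inj r b
        ...   | yes r→a | _       = via-a (inj₁ (Orbit-trans (Orbit-sym σ-inj r→a) r→x))
        ...   | no _    | yes r→b = via-a (inj₂ (Orbit-trans (Orbit-sym σ-inj r→b) r→x))
        ...   | no r↛a  | no r↛b  = lose (∈-filter⁺ keep? r∈ r↛b) (Orbit-σ⇒τ r↛a r↛b r→x)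

_≟ᵉ_ : DecidableEquality End
tl ≟ᵉ tl = yes refl
tl ≟ᵉ hd = no λ ()
hd ≟ᵉ tl = no λ ()
hd ≟ᵉ hd = yes refl

encodeEnd : End → Fin 2
encodeEnd tl = Data.Fin.zero
encodeEnd hd = Data.Fin.suc Data.Fin.zero

encodeEnd-injective : Injective _≡_ _≡_ encodeEnd
encodeEnd-injective {tl} {tl} _ = refl
encodeEnd-injective {hd} {hd} _ = refl

flipEnd-involutive : ∀ e → flipEnd (flipEnd e) ≡ e
flipEnd-involutive tl = refl
flipEnd-involutive hd = refl

module HalfArcs (D : Digraph) where

  _≟ʰ_ : DecidableEquality (HalfArc D)
  _≟ʰ_ = ≡-dec _≟ᶠ_ _≟ᵉ_

  encode : HalfArc D → Fin (nA D * 2)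
  encode (a , e) = combine a (encodeEnd e)

  encode-injective : Injective _≡_ _≡_ encode
  encode-injective {a , e} {b , e'} eq with combine-injective a (encodeEnd e) b (encodeEnd e') eq
  ... | refl , same = cong (a ,_) (encodeEnd-injective same)

  other-involutive : ∀ h → other D (other D h) ≡ h
  other-involutive (a , e) = cong (a ,_) (flipEnd-involutive e)

  other-injective : Injective _≡_ _≡_ (other D)
  other-injective = inverse⇒injective {g⁻¹ = other D} other-involutive

module Fibres {n n' : ℕ} (f : Fin n → Fin n') where

  fibre : Fin n' → List (Fin n)
  fibre w = filter (λ v → f v ≟ᶠ w) (allFin n)

  fibre-unique : ∀ w → Unique (fibre w)
  fibre-unique w = Unique.filter⁺ (λ v → f v ≟ᶠ w) (allFin⁺ n)

  ∈-fibre : ∀ z → z ∈ fibre (f z)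
  ∈-fibre z = ∈-filter⁺ (λ v → f v ≟ᶠ f z) (∈-allFin z) refl

  ∈-fibre⁺ : ∀ {w x} → f x ≡ w → x ∈ fibre w
  ∈-fibre⁺ {x = x} refl = ∈-fibre x

  ∈-fibre⁻ : ∀ {w x} → x ∈ fibre w → f x ≡ w
  ∈-fibre⁻ {w} x∈ = proj₂ (∈-filter⁻ (λ v → f v ≟ᶠ w) {xs = allFin n} x∈)

  private
    headOr : Fin n → List (Fin n) → Fin n
    headOr d []      = d
    headOr d (x ∷ _) = x

    headOr-∈ : ∀ {x d xs} → x ∈ xs → headOr d xs ∈ xs
    headOr-∈ (here _)  = here refl
    headOr-∈ (there _) = here refl

    headOr-default : ∀ {x d d' xs} → x ∈ xs → headOr d xs ≡ headOr d' xs
    headOr-default (here _)  = refl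
    headOr-default (there _) = refl

  representative : Fin n → Fin n
  representative z = headOr z (fibre (f z))

  representative-cong : ∀ {x y} → f x ≡ f y → representative x ≡ representative y
  representative-cong {x} {y} fx≡fy rewrite fx≡fy = headOr-default (∈-fibre y)

  f-representative : ∀ z → f (representative z) ≡ f z
  f-representative z = ∈-fibre⁻ (headOr-∈ {d = z} (∈-fibre z))

  representative-idempotent : ∀ z → representative (representative z) ≡ representative z
  representative-idempotent z = representative-cong (f-representative z)

  representative-head : ∀ {w v vs x} → fibre w ≡ v ∷ vs → x ∈ fibre w → representative x ≡ v
  representative-head {x = x} fibre≡ x∈ =
    trans (cong (λ c → headOr x (fibre c)) (∈-fibre⁻ x∈)) (cong (headOr x) fibre≡)

module _ {n : ℕ} where

  relabel : Fin n → Fin n → Fin n → Fin n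
  relabel u v c with c ≟ᶠ u
  ... | yes _ = v
  ... | no _  = c

  relabel-source : ∀ u v → relabel u v u ≡ v
  relabel-source u v with u ≟ᶠ u
  ... | yes _  = refl
  ... | no u≢u = ⊥-elim (u≢u refl)

  relabel-other : ∀ {u v c} → c ≢ u → relabel u v c ≡ c
  relabel-other {u} {v} {c} c≢u with c ≟ᶠ u
  ... | yes c≡u = ⊥-elim (c≢u c≡u)
  ... | no _    = refl

  relabel-preimage : ∀ {u v c} → relabel u v c ≡ v → c ≡ u ⊎ c ≡ v
  relabel-preimage {u} {v} {c} eq with c ≟ᶠ u
  ... | yes c≡u = inj₁ c≡u
  ... | no _    = inj₂ eq

excess≤1 : ∀ {s t A B} → s ≤ suc t → A + t ≤ B + s → A ≤ suc B
excess≤1 {s} {t} {A} {B} s≤1+t count = +-cancelʳ-≤ t A (suc B) (begin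
  A + t     ≤⟨ count ⟩
  B + s     ≤⟨ +-monoʳ-≤ B s≤1+t ⟩
  B + suc t ≡⟨ +-suc B t ⟩
  suc B + t ∎)
  where open ≤-Reasoning

excess≤0 : ∀ {s t A B} → s ≤ t → A + t ≤ B + s → A ≤ B
excess≤0 {s} {t} {A} {B} s≤t count = +-cancelʳ-≤ t A B (≤-trans count (+-monoʳ-≤ B s≤t))

excess-even : ∀ {s t n} → s + t ≡ n → s ≡ suc t → 2 ∣ suc n
excess-even {s} {t} {n} s+t≡n s≡1+t = divides (suc t) (begin
  suc n              ≡⟨ cong suc s+t≡n ⟨
  suc (s + t)        ≡⟨ cong (λ x → suc (x + t)) s≡1+t ⟩
  suc (suc t + t)    ≡⟨ +-suc (suc t) t ⟨
  suc t + suc t      ≡⟨ cong (suc t +_) (+-identityʳ (suc t)) ⟨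
  2 * suc t          ≡⟨ *-comm 2 (suc t) ⟩
  suc t * 2          ∎)
  where open ≡-Reasoning

module Identification (D : Digraph) (Φ : OrientedDirectedEmbedding D) {n' : ℕ} (f : Fin (nV D) → Fin n')
                      (𝒜 : List (HalfArc D)) (𝒜-antifaces : IsAntifaceSet (emb Φ) 𝒜) where

  open HalfArcs D
  open Swap _≟ʰ_
  open FiniteOrbits _≟ʰ_ encode encode-injective
  open Fibres f

  Ψ : OrientedEmbedding D
  Ψ = emb Φ

  On𝒜 : HalfArc D → Set
  On𝒜 = InFaces Ψ 𝒜

  On𝒜⇒head : ∀ {h} → On𝒜 h → proj₂ h ≡ hd
  On𝒜⇒head on𝒜 with find on𝒜
  ... | r , r∈ , (k , refl) = proj₁ 𝒜-antifaces r r∈ k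

  faceStepOf : (HalfArc D → HalfArc D) → HalfArc D → HalfArc D
  faceStepOf ρ h = ρ (other D h)

  -- An embedding of D / label: so far, each vertex u has been identified into the vertex label u.
  record Stage : Set where
    field
      rotation            : HalfArc D → HalfArc D
      rotation⁻¹          : HalfArc D → HalfArc D
      rotation-inv₁       : ∀ h → rotation (rotation⁻¹ h) ≡ h
      rotation-inv₂       : ∀ h → rotation⁻¹ (rotation h) ≡ h
      label               : Fin (nV D) → Fin (nV D)
      rotation-label      : ∀ h → label (vtx D (rotation h)) ≡ label (vtx D h)
      rotation-cycles     : ∀ h h' → label (vtx D h) ≡ label (vtx D h') → Orbit rotation h h'
      label-id-or-rep     : ∀ z → label z ≡ z ⊎ label z ≡ representative z
      faceStep-outside𝒜   : ∀ h → ¬ On𝒜 h → rotation (other D h) ≡ faceStep Ψ h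
      faceStep-end        : ∀ h → proj₂ (rotation (other D h)) ≡ proj₂ h
      antifaces           : List (HalfArc D)
      antifaces-represent : Representatives (faceStepOf rotation) On𝒜 antifaces

    rotation-injective : Injective _≡_ _≡_ rotation
    rotation-injective = inverse⇒injective {g⁻¹ = rotation⁻¹} rotation-inv₂

    faceStep-injective : Injective _≡_ _≡_ (faceStepOf rotation)
    faceStep-injective eq = other-injective (rotation-injective eq)

    f∘label : ∀ z → f (label z) ≡ f z
    f∘label z with label-id-or-rep z
    ... | inj₁ same = cong f same
    ... | inj₂ rep  = trans (cong f rep) (f-representative z)

    Orbit-rotation⇒label : ∀ {x y} → Orbit rotation x y → label (vtx D x) ≡ label (vtx D y)
    Orbit-rotation⇒label {x} (k , refl) = sym (go k)
      where
      go : ∀ k → label (vtx D (iter rotation k x)) ≡ label (vtx D x)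
      go zero    = refl
      go (suc k) = trans (rotation-label (iter rotation k x)) (go k)

  open Stage

  initial : Stage
  initial = record
    { rotation = rot Ψ ; rotation⁻¹ = rotInv Ψ ; rotation-inv₁ = rot-inv₁ Ψ ; rotation-inv₂ = rot-inv₂ Ψ
    ; label = λ z → z ; rotation-label = rot-vtx Ψ ; rotation-cycles = rot-cyc Ψ
    ; label-id-or-rep = λ _ → inj₁ refl
    ; faceStep-outside𝒜 = λ _ _ → refl
    ; faceStep-end = λ h → directed Φ h 1
    ; antifaces = 𝒜
    ; antifaces-represent = proj₂ 𝒜-antifaces , λ _ → mk⇔ (λ on → on) (λ on → on) }

  data Effect (S S' : Stage) (x y : HalfArc D) : Set where
    split : Orbit (faceStepOf (rotation S)) x y → length (antifaces S') ≤ suc (length (antifaces S)) →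
            ¬ Orbit (faceStepOf (rotation S')) x y → Effect S S' x y
    join  : ¬ Orbit (faceStepOf (rotation S)) x y → suc (length (antifaces S')) ≤ length (antifaces S) →
            Effect S S' x y

  record Merged (S : Stage) (u v : Fin (nV D)) (p q : HalfArc D) : Set where
    field
      stage      : Stage
      relabelled : ∀ z → label stage z ≡ relabel u v (label S z)
      effect     : Effect S stage (other D p) (other D q)

  module Merge (S : Stage) {u v : Fin (nV D)} {p q : HalfArc D}
               (p-at-u : vtx D p ≡ u) (q-at-v : label S (vtx D q) ≡ v)
               (rep-u : representative u ≡ v) (u≢v : u ≢ v) (u-unmerged : label S u ≡ u)
               (p̄-on𝒜 : On𝒜 (other D p)) (q̄-on𝒜 : On𝒜 (other D q)) where

    ρ : HalfArc D → HalfArc D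
    ρ = rotation S

    ρ' : HalfArc D → HalfArc D
    ρ' y = ρ (swap p q y)

    label' : Fin (nV D) → Fin (nV D)
    label' z = relabel u v (label S z)

    module Rotation = Transposition (rotation-injective S) p q (λ _ → refl)

    faceStep-swap : ∀ y → faceStepOf ρ' y ≡ faceStepOf ρ (swap (other D p) (other D q) y)
    faceStep-swap y = cong ρ (sym (swap-conjugate (other D) other-involutive p q y))

    module Face = Transposition (faceStep-injective S) (other D p) (other D q) faceStep-swap

    p-label : label S (vtx D p) ≡ u
    p-label = trans (cong (label S) p-at-u) u-unmerged

    labelled-u⇒u : ∀ z → label S z ≡ u → z ≡ u
    labelled-u⇒u z lz≡u with label-id-or-rep S z
    ... | inj₁ lz≡z   = trans (sym lz≡z) lz≡u
    ... | inj₂ lz≡rep = ⊥-elim (u≢v (begin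
      u                                  ≡⟨ lz≡u ⟨
      label S z                          ≡⟨ lz≡rep ⟩
      representative z                   ≡⟨ representative-idempotent z ⟨
      representative (representative z)  ≡⟨ cong representative (trans (sym lz≡rep) lz≡u) ⟩
      representative u                   ≡⟨ rep-u ⟩
      v                                  ∎))
      where open ≡-Reasoning

    p↛q : ¬ Orbit ρ p q
    p↛q p→q = u≢v (trans (sym p-label) (trans (Orbit-rotation⇒label S p→q) q-at-v))

    p̄≢q̄ : other D p ≢ other D q
    p̄≢q̄ p̄≡q̄ = p↛q (0 , other-injective p̄≡q̄)

    label'-p≡label'-q : label' (vtx D p) ≡ label' (vtx D q)
    label'-p≡label'-q = trans (cong (relabel u v) p-label)
      (trans (relabel-source u v) (sym (trans (cong (relabel u v) q-at-v) (relabel-other (λ v≡u → u≢v (sym v≡u))))))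

    rotation-label' : ∀ h → label' (vtx D (ρ' h)) ≡ label' (vtx D h)
    rotation-label' h = trans (cong (relabel u v) (rotation-label S (swap p q h)))
                              (swap-invariant (λ z → label' (vtx D z)) label'-p≡label'-q h)

    merged-class : ∀ y → label' (vtx D y) ≡ v → Orbit ρ p y ⊎ Orbit ρ q y
    merged-class y l'y≡v with relabel-preimage l'y≡v
    ... | inj₁ ly≡u = inj₁ (rotation-cycles S p y (trans p-label (sym ly≡u)))
    ... | inj₂ ly≡v = inj₂ (rotation-cycles S q y (trans q-at-v (sym ly≡v)))

    rotation-cycles' : ∀ h h' → label' (vtx D h) ≡ label' (vtx D h') → Orbit ρ' h h'
    rotation-cycles' h h' same with label' (vtx D h) ≟ᶠ v
    ... | yes l'h≡v = Orbit-trans (Orbit-sym Rotation.τ-injective (Rotation.join p↛q h (merged-class h l'h≡v)))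
                                  (Rotation.join p↛q h' (merged-class h' (trans (sym same) l'h≡v)))
    ... | no  l'h≢v = Rotation.Orbit-σ⇒τ h↛p h↛q (rotation-cycles S h h' old-same)
      where
      not-u : ∀ y → label' (vtx D y) ≢ v → label S (vtx D y) ≢ u
      not-u y l'y≢v ly≡u = l'y≢v (trans (cong (relabel u v) ly≡u) (relabel-source u v))
      unchanged : ∀ y → label' (vtx D y) ≢ v → label' (vtx D y) ≡ label S (vtx D y)
      unchanged y l'y≢v = relabel-other (not-u y l'y≢v)
      old-same : label S (vtx D h) ≡ label S (vtx D h')
      old-same = trans (sym (unchanged h l'h≢v)) (trans same (unchanged h' (λ l'h'≡v → l'h≢v (trans same l'h'≡v))))
      h↛p : ¬ Orbit ρ h p
      h↛p h→p = not-u h l'h≢v (trans (Orbit-rotation⇒label S h→p) p-label)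
      h↛q : ¬ Orbit ρ h q
      h↛q h→q = l'h≢v (trans (unchanged h l'h≢v) (trans (Orbit-rotation⇒label S h→q) q-at-v))

    label'-id-or-rep : ∀ z → label' z ≡ z ⊎ label' z ≡ representative z
    label'-id-or-rep z = byCase (label S z ≟ᶠ u)
      where
      byCase : Dec (label S z ≡ u) → label' z ≡ z ⊎ label' z ≡ representative z
      byCase (no lz≢u)  = Data.Sum.map (trans (relabel-other lz≢u)) (trans (relabel-other lz≢u)) (label-id-or-rep S z)
      byCase (yes lz≡u) = inj₂ (begin
        relabel u v (label S z) ≡⟨ cong (relabel u v) lz≡u ⟩
        relabel u v u           ≡⟨ relabel-source u v ⟩
        v                       ≡⟨ rep-u ⟨
        representative u        ≡⟨ cong representative (labelled-u⇒u z lz≡u) ⟨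
        representative z        ∎)
        where open ≡-Reasoning

    faceStep-outside𝒜' : ∀ h → ¬ On𝒜 h → ρ' (other D h) ≡ faceStep Ψ h
    faceStep-outside𝒜' h h∉𝒜 = trans (cong ρ (swap-other (not-at p̄-on𝒜) (not-at q̄-on𝒜))) (faceStep-outside𝒜 S h h∉𝒜)
      where
      not-at : ∀ {x} → On𝒜 (other D x) → other D h ≢ x
      not-at x̄-on𝒜 h̄≡x = h∉𝒜 (subst On𝒜 (trans (cong (other D) (sym h̄≡x)) (other-involutive h)) x̄-on𝒜)

    faceStep-end' : ∀ h → proj₂ (ρ' (other D h)) ≡ proj₂ h
    faceStep-end' h = trans (cong proj₂ (faceStep-swap h))
      (trans (faceStep-end S _) (swap-invariant proj₂ (trans (On𝒜⇒head p̄-on𝒜) (sym (On𝒜⇒head q̄-on𝒜))) h))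

    stageWith : (rs : List (HalfArc D)) → Representatives (faceStepOf ρ') On𝒜 rs → Stage
    stageWith rs reps = record
      { rotation = ρ' ; rotation⁻¹ = λ y → swap p q (rotation⁻¹ S y)
      ; rotation-inv₁ = λ h → trans (cong ρ (swap-involutive p q _)) (rotation-inv₁ S h)
      ; rotation-inv₂ = λ h → trans (cong (swap p q) (rotation-inv₂ S _)) (swap-involutive p q h)
      ; label = label' ; rotation-label = rotation-label' ; rotation-cycles = rotation-cycles'
      ; label-id-or-rep = label'-id-or-rep
      ; faceStep-outside𝒜 = faceStep-outside𝒜' ; faceStep-end = faceStep-end'
      ; antifaces = rs ; antifaces-represent = reps }

    merged : Merged S u v p q
    merged with Orbit? (faceStep-injective S) (other D p) (other D q)
    ... | yes p̄→q̄ with Face.representatives-split p̄-on𝒜 q̄-on𝒜 (antifaces-represent S) p̄≢q̄ p̄→q̄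
    ...   | rs , reps , longer = record
      { stage = stageWith rs reps ; relabelled = λ _ → refl
      ; effect = split p̄→q̄ longer (proj₁ (Face.split p̄≢q̄ p̄→q̄)) }
    merged | no p̄↛q̄ with Face.representatives-join p̄-on𝒜 q̄-on𝒜 (antifaces-represent S) p̄↛q̄
    ...   | rs , reps , shorter = record
      { stage = stageWith rs reps ; relabelled = λ _ → refl ; effect = join p̄↛q̄ shorter }

  On𝒜-backward : ∀ {x y} → Orbit (faceStep Ψ) x y → On𝒜 y → On𝒜 x
  On𝒜-backward x→y y-on𝒜 with find y-on𝒜
  ... | r , r∈ , r→y = lose r∈ (Orbit-trans r→y (Orbit-sym (faceStep-injective initial) x→y))

  -- p = ρ⁻¹ h for a half-arc h of 𝒜 at u; the face through other p continues with ρ p = h.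
  entering : ∀ {u} → IncidentWith Ψ 𝒜 u → Σ[ p ∈ HalfArc D ] vtx D p ≡ u × On𝒜 (other D p)
  entering (h , h-on𝒜 , h-at-u) = p , trans (trans (sym (rot-vtx Ψ p)) (cong (vtx D) (rot-inv₁ Ψ h))) h-at-u
                                    , On𝒜-backward (1 , trans (cong (rot Ψ) (other-involutive p)) (rot-inv₁ Ψ h)) h-on𝒜
    where
    p : HalfArc D
    p = rotInv Ψ h

  -- After an unmatched split, q̄₁ and q̄₂ lie on different faces, so the next surgery can be made a join.
  record FibreProgress (S : Stage) (K : ℕ) (v : Fin (nV D)) (n : ℕ) : Set where
    field
      splits joins : ℕ
      processed    : splits + joins ≡ n
      balanced     : splits ≤ suc joins
      count        : length (antifaces S) + joins ≤ K + splits
      q₁ q₂        : HalfArc D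
      q₁-at-v      : label S (vtx D q₁) ≡ v
      q₂-at-v      : label S (vtx D q₂) ≡ v
      q̄₁-on𝒜       : On𝒜 (other D q₁)
      q̄₂-on𝒜       : On𝒜 (other D q₂)
      separated    : splits ≡ suc joins → ¬ Orbit (faceStepOf (rotation S)) (other D q₁) (other D q₂)

  Absorption : Stage → ℕ → Fin (nV D) → Fin (nV D) → ℕ → Set
  Absorption S K v u n = Σ[ S' ∈ Stage ] (∀ z → label S' z ≡ relabel u v (label S z)) × FibreProgress S' K v (suc n)

  module Absorb {S : Stage} {K : ℕ} {v u : Fin (nV D)} {n : ℕ}
                (rep-u : representative u ≡ v) (u≢v : u ≢ v) (incident : IncidentWith Ψ 𝒜 u)
                (u-unmerged : label S u ≡ u) (progress : FibreProgress S K v n) where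

    open FibreProgress progress

    p : HalfArc D
    p = proj₁ (entering incident)

    p-at-u : vtx D p ≡ u
    p-at-u = proj₁ (proj₂ (entering incident))

    p̄-on𝒜 : On𝒜 (other D p)
    p̄-on𝒜 = proj₂ (proj₂ (entering incident))

    mergeAlong : ∀ {q} → label S (vtx D q) ≡ v → On𝒜 (other D q) → Merged S u v p q
    mergeAlong q-at-v q̄-on𝒜 = Merge.merged S p-at-u q-at-v rep-u u≢v u-unmerged p̄-on𝒜 q̄-on𝒜

    still-at-v : ∀ {q'} (m : Merged S u v p q') q → label S (vtx D q) ≡ v → label (Merged.stage m) (vtx D q) ≡ v
    still-at-v m _ q-at-v =
      trans (Merged.relabelled m _) (trans (cong (relabel u v) q-at-v) (relabel-other (λ v≡u → u≢v (sym v≡u))))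

    afterJoin : ∀ {q} (m : Merged S u v p q) → suc (length (antifaces (Merged.stage m))) ≤ length (antifaces S) →
                Absorption S K v u n
    afterJoin m shorter = stage , relabelled , record
      { splits = splits ; joins = suc joins ; processed = trans (+-suc splits joins) (cong suc processed)
      ; balanced = m≤n⇒m≤1+n balanced
      ; count = ≤-trans (≤-reflexive (+-suc _ joins)) (≤-trans (+-monoˡ-≤ joins shorter) count)
      ; q₁ = q₁ ; q₂ = q₂ ; q₁-at-v = still-at-v m q₁ q₁-at-v ; q₂-at-v = still-at-v m q₂ q₂-at-v
      ; q̄₁-on𝒜 = q̄₁-on𝒜 ; q̄₂-on𝒜 = q̄₂-on𝒜
      ; separated = λ s≡2+t → ⊥-elim (<⇒≢ (s≤s balanced) s≡2+t) }
      where open Merged m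

    joinAlong : ∀ {q} → label S (vtx D q) ≡ v → On𝒜 (other D q) →
                ¬ Orbit (faceStepOf (rotation S)) (other D p) (other D q) → Absorption S K v u n
    joinAlong q-at-v q̄-on𝒜 p̄↛q̄ with mergeAlong q-at-v q̄-on𝒜
    ... | m with Merged.effect m
    ...   | split p̄→q̄ _ _ = ⊥-elim (p̄↛q̄ p̄→q̄)
    ...   | join _ shorter = afterJoin m shorter

    absorbed : Absorption S K v u n
    absorbed with splits ≟ suc joins
    ... | yes s≡1+t with Orbit? (faceStep-injective S) (other D p) (other D q₁)
    ...   | no  p̄↛q̄₁ = joinAlong q₁-at-v q̄₁-on𝒜 p̄↛q̄₁
    ...   | yes p̄→q̄₁ = joinAlong q₂-at-v q̄₂-on𝒜 λ p̄→q̄₂ →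
                          separated s≡1+t (Orbit-trans (Orbit-sym (faceStep-injective S) p̄→q̄₁) p̄→q̄₂)
    absorbed | no s≢1+t with mergeAlong q₁-at-v q̄₁-on𝒜
    ... | m with Merged.effect m
    ...   | join _ shorter = afterJoin m shorter
    ...   | split _ longer p̄↛q̄₁ = stage , relabelled , record
      { splits = suc splits ; joins = joins ; processed = cong suc processed
      ; balanced = ≤∧≢⇒< balanced s≢1+t
      ; count = ≤-trans (+-monoˡ-≤ joins longer) (≤-trans (s≤s count) (≤-reflexive (sym (+-suc K splits))))
      ; q₁ = q₁ ; q₂ = p ; q₁-at-v = still-at-v m q₁ q₁-at-v
      ; q₂-at-v = trans (relabelled _) (trans (cong (relabel u v) (trans (cong (label S) p-at-u) u-unmerged))
                                              (relabel-source u v))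
      ; q̄₁-on𝒜 = q̄₁-on𝒜 ; q̄₂-on𝒜 = p̄-on𝒜
      ; separated = λ _ q̄₁→p̄ → p̄↛q̄₁ (Orbit-sym (faceStep-injective stage) q̄₁→p̄) }
      where open Merged m

  record Absorbed (S : Stage) (K : ℕ) (v : Fin (nV D)) (rest : List (Fin (nV D))) (n : ℕ) : Set where
    field
      stage    : Stage
      progress : FibreProgress stage K v (length rest + n)
      outside  : ∀ z → ¬ label S z ∈ rest → label stage z ≡ label S z
      inside   : ∀ z → label S z ∈ rest → label stage z ≡ v

  absorbAll : ∀ {K v} (rest : List (Fin (nV D))) → Unique rest →
              (∀ {u} → u ∈ rest → representative u ≡ v × u ≢ v × IncidentWith Ψ 𝒜 u) →
              ∀ {S n} → (∀ {u} → u ∈ rest → label S u ≡ u) → FibreProgress S K v n → Absorbed S K v rest n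
  absorbAll []         _                 _       {S} _        progress =
    record { stage = S ; progress = progress ; outside = λ _ _ → refl ; inside = λ _ () }
  absorbAll {K} {v} (u ∷ rest) (u∉rest ∷ unique) members {S} {n} unmerged progress = record
    { stage = Rest.stage
    ; progress = subst (FibreProgress Rest.stage K v) (+-suc (length rest) n) Rest.progress
    ; outside = outside ; inside = inside }
    where
    member-u : representative u ≡ v × u ≢ v × IncidentWith Ψ 𝒜 u
    member-u = members (here refl)
    absorbed-u : Absorption S K v u n
    absorbed-u = Absorb.absorbed (proj₁ member-u) (proj₁ (proj₂ member-u)) (proj₂ (proj₂ member-u)) (unmerged (here refl)) progress
    S₁ : Stage
    S₁ = proj₁ absorbed-u
    relabelled : ∀ z → label S₁ z ≡ relabel u v (label S z)
    relabelled = proj₁ (proj₂ absorbed-u)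
    kept : ∀ {z} → label S z ≢ u → label S₁ z ≡ label S z
    kept lz≢u = trans (relabelled _) (relabel-other lz≢u)
    module Rest = Absorbed (absorbAll rest unique (λ u'∈ → members (there u'∈))
      (λ u'∈ → trans (kept (λ u'≡u → All.lookup u∉rest u'∈ (sym (trans (sym (unmerged (there u'∈))) u'≡u))))
                     (unmerged (there u'∈)))
      (proj₂ (proj₂ absorbed-u)))
    v∉rest : ¬ v ∈ rest
    v∉rest v∈ = proj₁ (proj₂ (members (there v∈))) refl
    outside : ∀ z → ¬ label S z ∈ u ∷ rest → label Rest.stage z ≡ label S z
    outside z lz∉ = trans (Rest.outside z (λ l₁z∈ → lz∉ (there (subst (_∈ rest) (kept lz≢u) l₁z∈)))) (kept lz≢u)
      where
      lz≢u : label S z ≢ u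
      lz≢u lz≡u = lz∉ (here lz≡u)
    inside : ∀ z → label S z ∈ u ∷ rest → label Rest.stage z ≡ v
    inside z (here lz≡u) = trans (Rest.outside z (subst (λ c → ¬ c ∈ rest) (sym l₁z≡v) v∉rest)) l₁z≡v
      where
      l₁z≡v : label S₁ z ≡ v
      l₁z≡v = trans (relabelled z) (trans (cong (relabel u v) lz≡u) (relabel-source u v))
    inside z (there lz∈) = Rest.inside z (subst (_∈ rest) (sym (kept λ lz≡u → All.lookup u∉rest lz∈ (sym lz≡u))) lz∈)

  record FibreMerged (S : Stage) (w : Fin n') : Set where
    field
      stage     : Stage
      count     : length (antifaces stage) ≤ suc (length (antifaces S))
      count-odd : ¬ 2 ∣ preimageSize f w → length (antifaces stage) ≤ length (antifaces S)
      outside   : ∀ z → f z ≢ w → label stage z ≡ label S z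
      inside    : ∀ z → f z ≡ w → label stage z ≡ representative z

  Incidence : Set
  Incidence = ∀ w → preimageSize f w ≥ 2 → ∀ v → f v ≡ w → IncidentWith Ψ 𝒜 v

  module LargeFibre (incidence : Incidence) {w : Fin n'} {S : Stage} (unmerged : ∀ z → f z ≡ w → label S z ≡ z)
                    {v : Fin (nV D)} {rest : List (Fin (nV D))} (fibre≡ : fibre w ≡ v ∷ rest)
                    (large : preimageSize f w ≥ 2) where

    in-fibre : ∀ {x} → x ∈ v ∷ rest → f x ≡ w
    in-fibre x∈ = ∈-fibre⁻ (subst (_ ∈_) (sym fibre≡) x∈)

    unique : Unique (v ∷ rest)
    unique = subst Unique fibre≡ (fibre-unique w)

    members : ∀ {u} → u ∈ rest → representative u ≡ v × u ≢ v × IncidentWith Ψ 𝒜 u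
    members {u} u∈ = representative-head fibre≡ (∈-fibre⁺ (in-fibre (there u∈)))
                   , (λ u≡v → All.lookup (AllPairs.head unique) u∈ (sym u≡v))
                   , incidence w large u (in-fibre (there u∈))

    start : FibreProgress S (length (antifaces S)) v 0
    start = record
      { splits = 0 ; joins = 0 ; processed = refl ; balanced = z≤n ; count = ≤-refl
      ; q₁ = q ; q₂ = q ; q₁-at-v = q-at-v ; q₂-at-v = q-at-v ; q̄₁-on𝒜 = q̄-on𝒜 ; q̄₂-on𝒜 = q̄-on𝒜
      ; separated = λ () }
      where
      entry : Σ[ p ∈ HalfArc D ] vtx D p ≡ v × On𝒜 (other D p)
      entry = entering (incidence w large v (in-fibre (here refl)))
      q : HalfArc D
      q = proj₁ entry
      q-at-v : label S (vtx D q) ≡ v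
      q-at-v = trans (cong (label S) (proj₁ (proj₂ entry))) (unmerged v (in-fibre (here refl)))
      q̄-on𝒜 : On𝒜 (other D q)
      q̄-on𝒜 = proj₂ (proj₂ entry)

    module Done = Absorbed (absorbAll rest (AllPairs.tail unique) members (λ u∈ → unmerged _ (in-fibre (there u∈))) start)
    open FibreProgress Done.progress

    merged : FibreMerged S w
    merged = record
      { stage = Done.stage
      ; count = excess≤1 balanced count
      ; count-odd = λ odd → excess≤0 (≤-pred (≤∧≢⇒< balanced λ s≡1+t → odd (subst (2 ∣_) size≡ (excess-even processed s≡1+t)))) count
      ; outside = λ z fz≢w → Done.outside z λ lz∈ → fz≢w (trans (sym (f∘label S z)) (in-fibre (there lz∈)))
      ; inside = inside }
      where
      size≡ : suc (length rest + 0) ≡ preimageSize f w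
      size≡ = trans (cong suc (+-identityʳ _)) (sym (cong length fibre≡))
      inside : ∀ z → f z ≡ w → label Done.stage z ≡ representative z
      inside z fz≡w with subst (z ∈_) fibre≡ (∈-fibre⁺ fz≡w)
      ... | here refl = trans (trans (Done.outside v v∉rest) (unmerged v fz≡w)) (sym (representative-head fibre≡ (∈-fibre⁺ fz≡w)))
        where
        v∉rest : ¬ label S v ∈ rest
        v∉rest lv∈ = All.lookup (AllPairs.head unique) (subst (_∈ rest) (unmerged v fz≡w) lv∈) refl
      ... | there z∈ = trans (Done.inside z (subst (_∈ rest) (sym (unmerged z fz≡w)) z∈)) (sym (representative-head fibre≡ (∈-fibre⁺ fz≡w)))

  evenFibre? : (w : Fin n') → Dec (2 ∣ preimageSize f w)
  evenFibre? w = 2 ∣? preimageSize f w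

  record AllMerged (S : Stage) (ws : List (Fin n')) : Set where
    field
      stage   : Stage
      count   : length (antifaces stage) ≤ length (antifaces S) + length (filter evenFibre? ws)
      outside : ∀ z → ¬ f z ∈ ws → label stage z ≡ label S z
      inside  : ∀ z → f z ∈ ws → label stage z ≡ representative z

  vtx-/ : ∀ h → vtx (D / f) h ≡ f (vtx D h)
  vtx-/ (_ , tl) = refl
  vtx-/ (_ , hd) = refl

  module Identified (incidence : Incidence) where

    unchangedFibre : ∀ {S w} → (∀ z → f z ≡ w → label S z ≡ representative z) → FibreMerged S w
    unchangedFibre {S} done = record
      { stage = S ; count = n≤1+n _ ; count-odd = λ _ → ≤-refl ; outside = λ _ _ → refl ; inside = done }

    mergeFibre : (w : Fin n') (S : Stage) → (∀ z → f z ≡ w → label S z ≡ z) → FibreMerged S w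
    mergeFibre w S unmerged = byFibre (fibre w) refl
      where
      byFibre : (vs : List (Fin (nV D))) → fibre w ≡ vs → FibreMerged S w
      byFibre []           empty  = unchangedFibre λ z fz≡w → case subst (z ∈_) empty (∈-fibre⁺ fz≡w) of λ ()
      byFibre (v ∷ [])     single = unchangedFibre λ z fz≡w → case subst (z ∈_) single (∈-fibre⁺ fz≡w) of λ where
        (here z≡v) → trans (unmerged z fz≡w) (trans z≡v (sym (representative-head single (∈-fibre⁺ fz≡w))))
      byFibre (v ∷ u ∷ us) fibre≡ =
        LargeFibre.merged incidence unmerged fibre≡ (subst (_≥ 2) (sym (cong length fibre≡)) (s≤s (s≤s z≤n)))

    mergeFibres : (ws : List (Fin n')) → Unique ws → (S : Stage) → (∀ z → f z ∈ ws → label S z ≡ z) → AllMerged S ws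
    mergeFibres []       _                 S _        = record
      { stage = S ; count = m≤m+n _ _ ; outside = λ _ _ → refl ; inside = λ _ () }
    mergeFibres (w ∷ ws) (w∉ws ∷ unique) S unmerged = record
      { stage = Rest.stage
      ; count = ≤-trans Rest.count fibreCount
      ; outside = λ z fz∉ → trans (Rest.outside z (λ fz∈ → fz∉ (there fz∈))) (First.outside z (λ fz≡w → fz∉ (here fz≡w)))
      ; inside = inside }
      where
      module First = FibreMerged (mergeFibre w S (λ z fz≡w → unmerged z (here fz≡w)))
      not-w : ∀ {z} → f z ∈ ws → f z ≢ w
      not-w fz∈ fz≡w = All.lookup w∉ws fz∈ (sym fz≡w)
      module Rest = AllMerged (mergeFibres ws unique First.stage
                                 (λ z fz∈ → trans (First.outside z (not-w fz∈)) (unmerged z (there fz∈))))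
      fibreCount : length (antifaces First.stage) + length (filter evenFibre? ws)
                 ≤ length (antifaces S) + length (filter evenFibre? (w ∷ ws))
      fibreCount with evenFibre? w
      ... | yes even = ≤-trans (+-monoˡ-≤ _ First.count) (≤-reflexive (trans (sym (+-suc _ _))
                         (cong (λ ws' → length (antifaces S) + length ws') (sym (filter-accept evenFibre? even)))))
      ... | no  odd  = ≤-trans (+-monoˡ-≤ _ (First.count-odd odd))
                         (≤-reflexive (cong (λ ws' → length (antifaces S) + length ws') (sym (filter-reject evenFibre? odd))))
      inside : ∀ z → f z ∈ w ∷ ws → label Rest.stage z ≡ representative z
      inside z (here fz≡w) = trans (Rest.outside z (λ fz∈ → not-w fz∈ fz≡w)) (First.inside z fz≡w)
      inside z (there fz∈) = Rest.inside z fz∈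

    module Final = AllMerged (mergeFibres (allFin n') (allFin⁺ n') initial (λ _ _ → refl))

    label-final : ∀ z → label Final.stage z ≡ representative z
    label-final z = Final.inside z (∈-allFin (f z))

    identifiedEmbedding : OrientedEmbedding (D / f)
    identifiedEmbedding = record
      { rot = rotation Final.stage ; rotInv = rotation⁻¹ Final.stage
      ; rot-inv₁ = rotation-inv₁ Final.stage ; rot-inv₂ = rotation-inv₂ Final.stage
      ; rot-vtx = λ h → trans (vtx-/ (rotation Final.stage h)) (trans (f∘rotation h) (sym (vtx-/ h)))
      ; rot-cyc = λ h h' same → rotation-cycles Final.stage h h'
          (trans (label-final _) (trans (representative-cong (trans (sym (vtx-/ h)) (trans same (vtx-/ h'))))
                                        (sym (label-final _)))) }
      where
      f∘rotation : ∀ h → f (vtx D (rotation Final.stage h)) ≡ f (vtx D h)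
      f∘rotation h = trans (sym (f∘label Final.stage _))
                       (trans (cong f (rotation-label Final.stage h)) (f∘label Final.stage _))

    identifiedDirected : IsDirected identifiedEmbedding
    identifiedDirected h zero    = refl
    identifiedDirected h (suc k) = trans (faceStep-end Final.stage _) (identifiedDirected h k)

    faces-outside𝒜 : ∀ h → ¬ On𝒜 h → ∀ k → iter (faceStep identifiedEmbedding) k h ≡ iter (faceStep Ψ) k h
    faces-outside𝒜 h h∉𝒜 zero    = refl
    faces-outside𝒜 h h∉𝒜 (suc k) = trans (cong (faceStep identifiedEmbedding) (faces-outside𝒜 h h∉𝒜 k))
      (faceStep-outside𝒜 Final.stage _ λ on𝒜 → h∉𝒜 (On𝒜-backward (k , refl) on𝒜))

    antifaces-final : IsAntifaceSet identifiedEmbedding (antifaces Final.stage)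
    antifaces-final = (λ r r∈ k → trans (identifiedDirected r k)
                                         (On𝒜⇒head (Representatives-member (antifaces-represent Final.stage) r∈)))
                    , proj₁ (antifaces-represent Final.stage)

corollary4p3 :
    (D : Digraph) → Eulerian D →
    (Φ : OrientedDirectedEmbedding D) →
    {n' : ℕ} → (f : Fin (nV D) → Fin n') → (ℓ : ℕ) → OddVertexIdentification f ℓ →
    (𝒜 : List (HalfArc D)) → IsAntifaceSet (emb Φ) 𝒜 →
    (∀ w → preimageSize f w ≥ 2 → ∀ v → f v ≡ w → IncidentWith (emb Φ) 𝒜 v) →
    Σ (OrientedDirectedEmbedding (D / f)) λ Φ' →
    Σ (List (HalfArc (D / f))) λ 𝒜' →
      IsAntifaceSet (emb Φ') 𝒜' ×
      length 𝒜' ≤ length 𝒜 + ℓ ×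
      (∀ h → InFaces (emb Φ) 𝒜 h ⇔ InFaces (emb Φ') 𝒜' h) ×
      (∀ h → ¬ InFaces (emb Φ) 𝒜 h →
        ∀ k → iter (faceStep (emb Φ')) k h ≡ iter (faceStep (emb Φ)) k h)
corollary4p3 D _ Φ f ℓ (_ , exceptional) 𝒜 𝒜-antifaces incidence =
  record { emb = identifiedEmbedding ; directed = identifiedDirected } ,
  Stage.antifaces Final.stage ,
  antifaces-final ,
  subst (λ e → length (Stage.antifaces Final.stage) ≤ length 𝒜 + e) exceptional Final.count ,
  proj₂ (Stage.antifaces-represent Final.stage) ,
  faces-outside𝒜
  where
  open Identification D Φ f 𝒜 𝒜-antifaces
  open Identified incidence
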